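{- Let $G$ be a finite, simple, undirected graph and let $Q\subseteq V(G)$ be a 3-covering of $G$. Let $uv\in E(G)$ be an edge with $u\notin Q$, $v\notin Q$, and such that neither $u$ nor $v$ is a pendant vertex. Then there exist vertices $x,w\in Q$, with $x,w\notin\{u,v\}$, $xu\in E(G)$ and $vw\in E(G)$; thus either $x\neq w$ and $x,u,v,w$ is a path on 4 vertices whose two end vertices lie in $Q$, or $x=w$ and $x,u,v$ form a triangle with $x\in Q$. Moreover, if $uv$ and $u'v'$ are two edges each of which satisfies the hypotheses above (both endpoints outside $Q$ and neither endpoint pendant), then either they have no vertex in common or $\{u,v\}=\{u',v'\}$.
   Context: A path on 3 vertices (a 3-path) is a sequence $a,b,c$ of three distinct vertices with $ab,bc\in E(G)$. A 3-covering of $G$ is a set $Q$ of vertices such that every 3-path of $G$ contains at least one vertex of $Q$. A pendant vertex is a vertex of degree $1$. -}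

module Defs where

open import Data.Nat using (ℕ)
open import Data.Fin using (Fin)
open import Data.Fin.Subset using (Subset; _∈_; _∉_)
open import Data.List using (length; filter; allFin)
open import Data.Product using (_×_; Σ-syntax)
open import Data.Sum using (_⊎_)
open import Relation.Nullary using (¬_; Dec)
open import Relation.Binary.PropositionalEquality using (_≡_; _≢_)
open import Level using (0ℓ)

record Graph (n : ℕ) : Set₁ where
  field
    Adj    : Fin n → Fin n → Set
    adj?   : (u v : Fin n) → Dec (Adj u v)
    sym    : ∀ {u v} → Adj u v → Adj v u
    irrefl : ∀ {u} → ¬ Adj u u

open Graph public

degree : ∀ {n} (G : Graph n) → Fin n → ℕ
degree G v = length (filter (adj? G v) (allFin _))

Pendant : ∀ {n} (G : Graph n) → Fin n → Set
Pendant G v = degree G v ≡ 1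

Path3 : ∀ {n} (G : Graph n) → Fin n → Fin n → Fin n → Set
Path3 G a b c = a ≢ b × b ≢ c × a ≢ c × Adj G a b × Adj G b c

ThreeCovering : ∀ {n} (G : Graph n) → Subset n → Set
ThreeCovering G Q = ∀ a b c → Path3 G a b c → a ∈ Q ⊎ b ∈ Q ⊎ c ∈ Q

GoodEdge : ∀ {n} (G : Graph n) → Subset n → Fin n → Fin n → Set
GoodEdge G Q u v =
  Adj G u v × u ∉ Q × v ∉ Q × ¬ Pendant G u × ¬ Pendant G v

module Submission where

-- Everything rests on one observation about a 3-covering Q:
-- if uv is an edge with u, v ∉ Q, then every neighbour y ≠ v of u lies in Q,
-- since y,u,v is a 3-path whose only possible vertex in Q is y
-- (`other-neighbour-in-cover`).
--   * First claim: a non-pendant vertex with a neighbour u has a second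
--     neighbour y ≠ u (`second-neighbour`; this is where the degree count
--     enters, via `filter-singleton`).  Applied to u (away from v) and to v
--     (away from u) it yields x, w ∈ Q flanking uv, and a plain case split on
--     x ≟ w turns x,u,v,w into a 4-path or a triangle (`path-or-triangle`).
--   * Second claim: by the observation, a vertex outside Q has at most one
--     neighbour outside Q (`partner-unique`), so two such edges sharing an
--     endpoint coincide.

open import Defs
open import Data.Nat using (ℕ)
open import Data.Fin using (Fin; _≟_)
open import Data.Fin.Properties using (any?)
open import Data.Fin.Subset using (Subset; _∈_; _∉_)
open import Data.Product using (_×_; Σ-syntax; _,_)
open import Data.Sum using (_⊎_; inj₁; inj₂)
open import Data.Empty using (⊥-elim)
open import Data.List using (List; []; _∷_; length; filter; allFin)
open import Data.List.Properties using (filter-accept; filter-reject; filter-none)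
open import Data.List.Membership.Propositional using () renaming (_∈_ to _∈ₗ_)
open import Data.List.Membership.Propositional.Properties using (∈-allFin)
open import Data.List.Relation.Unary.Any using (here; there)
import Data.List.Relation.Unary.All as All
open import Data.List.Relation.Unary.AllPairs using (_∷_)
open import Data.List.Relation.Unary.Unique.Propositional using (Unique)
open import Data.List.Relation.Unary.Unique.Propositional.Properties using (allFin⁺)
open import Relation.Nullary using (¬_; Dec; yes; no)
open import Relation.Nullary.Decidable using (_×-dec_; ¬?)
open import Relation.Binary.PropositionalEquality
  using (_≡_; _≢_; refl; cong; module ≡-Reasoning) renaming (sym to ≡-sym)

-- In a duplicate-free list, a predicate holding at exactly one member u
-- filters the list down to [u].  This is what makes "degree 1" computable.
module _ {A : Set} {P : A → Set} (P? : ∀ x → Dec (P x)) where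

  filter-singleton : {u : A} (xs : List A) → Unique xs → u ∈ₗ xs → P u →
    (∀ {y} → y ∈ₗ xs → P y → y ≡ u) → filter P? xs ≡ u ∷ []
  filter-singleton (x ∷ xs) (x∉xs ∷ _) (here refl) Pu only = begin
    filter P? (x ∷ xs)  ≡⟨ filter-accept P? Pu ⟩
    x ∷ filter P? xs    ≡⟨ cong (x ∷_) (filter-none P? (All.tabulate no-other)) ⟩
    x ∷ []              ∎
    where
    open ≡-Reasoning
    no-other : ∀ {y} → y ∈ₗ xs → ¬ P y
    no-other y∈xs Py = All.lookup x∉xs y∈xs (≡-sym (only (there y∈xs) Py))
  filter-singleton (x ∷ xs) (x∉xs ∷ uniq) (there u∈xs) Pu only = begin
    filter P? (x ∷ xs)  ≡⟨ filter-reject P? (λ Px → All.lookup x∉xs u∈xs (only (here refl) Px)) ⟩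
    filter P? xs        ≡⟨ filter-singleton xs uniq u∈xs Pu (λ y∈xs → only (there y∈xs)) ⟩
    _ ∷ []              ∎
    where open ≡-Reasoning

module _ {n : ℕ} (G : Graph n) where

  adj⇒≢ : ∀ {a b} → Adj G a b → a ≢ b
  adj⇒≢ ab refl = irrefl G ab

  sole-neighbour⇒pendant : ∀ {v u} → Adj G v u →
    (∀ y → Adj G v y → y ≡ u) → Pendant G v
  sole-neighbour⇒pendant {v} {u} vu only =
    cong length
      (filter-singleton (adj? G v) (allFin n) (allFin⁺ n) (∈-allFin u) vu
        (λ {y} _ → only y))

  second-neighbour : ∀ {v u} → Adj G v u → ¬ Pendant G v →
    Σ[ y ∈ Fin n ] (Adj G v y × y ≢ u)
  second-neighbour {v} {u} vu non-pendant
    with any? (λ y → adj? G v y ×-dec ¬? (y ≟ u))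
  ... | yes found = found
  ... | no none = ⊥-elim (non-pendant (sole-neighbour⇒pendant vu equals-u))
    where
    equals-u : ∀ y → Adj G v y → y ≡ u
    equals-u y vy with y ≟ u
    ... | yes y≡u = y≡u
    ... | no y≢u = ⊥-elim (none (y , vy , y≢u))

  PathOrTriangle : Fin n → Fin n → Fin n → Fin n → Set
  PathOrTriangle x u v w =
    (x ≢ w × x ≢ u × x ≢ v × u ≢ v × u ≢ w × v ≢ w
      × Adj G x u × Adj G u v × Adj G v w)
    ⊎ (x ≡ w × Adj G x u × Adj G u v × Adj G v x)

  path-or-triangle : ∀ {x u v w} → x ≢ v → w ≢ u →
    Adj G x u → Adj G u v → Adj G v w → PathOrTriangle x u v w
  path-or-triangle {x} {u} {v} {w} x≢v w≢u xu uv vw with x ≟ w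
  ... | yes refl = inj₂ (refl , xu , uv , vw)
  ... | no x≢w = inj₁ (x≢w , adj⇒≢ xu , x≢v , adj⇒≢ uv , (λ u≡w → w≢u (≡-sym u≡w))
                      , adj⇒≢ vw , xu , uv , vw)

  module _ {Q : Subset n} (cover : ThreeCovering G Q) where

    -- The key observation: if uv is an edge outside Q, every other
    -- neighbour y of u lies in Q, as y,u,v is a 3-path.
    other-neighbour-in-cover : ∀ {u v y} → Adj G u v → u ∉ Q → v ∉ Q →
      Adj G y u → y ≢ v → y ∈ Q
    other-neighbour-in-cover uv u∉Q v∉Q yu y≢v
      with cover _ _ _ (adj⇒≢ yu , adj⇒≢ uv , y≢v , yu , uv)
    ... | inj₁ y∈Q = y∈Q
    ... | inj₂ (inj₁ u∈Q) = ⊥-elim (u∉Q u∈Q)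
    ... | inj₂ (inj₂ v∈Q) = ⊥-elim (v∉Q v∈Q)

    partner-unique : ∀ {u v v′} → Adj G u v → Adj G u v′ →
      u ∉ Q → v ∉ Q → v′ ∉ Q → v′ ≡ v
    partner-unique {v′ = v′} uv uv′ u∉Q v∉Q v′∉Q with v′ ≟ _
    ... | yes v′≡v = v′≡v
    ... | no v′≢v = ⊥-elim (v′∉Q (other-neighbour-in-cover uv u∉Q v∉Q (sym G uv′) v′≢v))

    good-edge-flanked : ∀ u v → GoodEdge G Q u v →
      Σ[ x ∈ Fin n ] Σ[ w ∈ Fin n ]
        (x ∈ Q × w ∈ Q × x ≢ u × x ≢ v × w ≢ u × w ≢ v
          × Adj G x u × Adj G v w × PathOrTriangle x u v w)
    good-edge-flanked u v (uv , u∉Q , v∉Q , u-non-pendant , v-non-pendant)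
      with second-neighbour uv u-non-pendant
         | second-neighbour (sym G uv) v-non-pendant
    ... | x , ux , x≢v | w , vw , w≢u =
      x , w , x∈Q , w∈Q , adj⇒≢ xu , x≢v , w≢u , adj⇒≢ wv , xu , vw
        , path-or-triangle x≢v w≢u xu uv vw
      where
      xu = sym G ux
      wv = sym G vw
      x∈Q = other-neighbour-in-cover uv u∉Q v∉Q xu x≢v
      w∈Q = other-neighbour-in-cover (sym G uv) v∉Q u∉Q wv w≢u

    good-edges-disjoint-or-equal : ∀ u v u′ v′ →
      GoodEdge G Q u v → GoodEdge G Q u′ v′ →
      (u ≢ u′ × u ≢ v′ × v ≢ u′ × v ≢ v′)
      ⊎ ((u ≡ u′ × v ≡ v′) ⊎ (u ≡ v′ × v ≡ u′))
    good-edges-disjoint-or-equal u v u′ v′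
      (uv , u∉Q , v∉Q , _) (u′v′ , u′∉Q , v′∉Q , _)
      with u ≟ u′ | u ≟ v′ | v ≟ u′ | v ≟ v′
    ... | yes refl | _ | _ | _ =
      inj₂ (inj₁ (refl , ≡-sym (partner-unique uv u′v′ u∉Q v∉Q v′∉Q)))
    ... | no _ | yes refl | _ | _ =
      inj₂ (inj₂ (refl , ≡-sym (partner-unique uv (sym G u′v′) u∉Q v∉Q u′∉Q)))
    ... | no _ | no _ | yes refl | _ =
      inj₂ (inj₂ (≡-sym (partner-unique (sym G uv) u′v′ v∉Q u∉Q v′∉Q) , refl))
    ... | no _ | no _ | no _ | yes refl =
      inj₂ (inj₁ (≡-sym (partner-unique (sym G uv) (sym G u′v′) v∉Q u∉Q u′∉Q) , refl))
    ... | no u≢u′ | no u≢v′ | no v≢u′ | no v≢v′ = inj₁ (u≢u′ , u≢v′ , v≢u′ , v≢v′)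

theorem3 : (n : ℕ) (G : Graph n) (Q : Subset n) → ThreeCovering G Q →
    ((u v : Fin n) → GoodEdge G Q u v →
      Σ[ x ∈ Fin n ] Σ[ w ∈ Fin n ]
        (x ∈ Q × w ∈ Q × x ≢ u × x ≢ v × w ≢ u × w ≢ v
          × Adj G x u × Adj G v w
          × ((x ≢ w × x ≢ u × x ≢ v × u ≢ v × u ≢ w × v ≢ w
               × Adj G x u × Adj G u v × Adj G v w)
             ⊎ (x ≡ w × Adj G x u × Adj G u v × Adj G v x))))
    × ((u v u′ v′ : Fin n) → GoodEdge G Q u v → GoodEdge G Q u′ v′ →
        ((u ≢ u′ × u ≢ v′ × v ≢ u′ × v ≢ v′)
         ⊎ ((u ≡ u′ × v ≡ v′) ⊎ (u ≡ v′ × v ≡ u′))))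
theorem3 n G Q cover =
  good-edge-flanked G cover , good-edges-disjoint-or-equal G cover
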